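{- Let $z\in\{0,1\}^n$ satisfy a term $T^\star$ of size $a$. Let $\mathcal{L}$ be a set of terms such that every $T\in\mathcal{L}$ satisfies (a) $|T|\ge 0.99a$ and (b) $|T\setminus T^\star|\le 2a/\log(ns)$. Then there exist at least $a/100$ coordinates which are $(z,\mathcal{L})$-super popular and which are indices of literals in $T^\star$.
   Context: A term is a conjunction of literals, identified with its set of literals; $|T|$ is its number of literals. For $y\in\{0,1\}^n$, the literal corresponding to $y_i$ is $x_i$ if $y_i=1$ and $\overline{x}_i$ if $y_i=0$. A coordinate $i\in[n]$ is $(z,\mathcal{L})$-super popular if the literal corresponding to $z_i$ appears in at least $0.01|\mathcal{L}|$ terms of $\mathcal{L}$. Here $s$ is the number of terms of the underlying target DNF; standing assumption: $n$ and $s$ are at least a sufficiently large absolute constant; logarithms are base 2. -}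

module Defs where

open import Data.Nat using (ℕ; zero; suc; _+_; _*_; _^_; _≤_)
open import Data.Bool using (Bool; true; false)
open import Data.Fin using (Fin)
open import Data.Fin.Subset using (Subset; _∈_; _─_; ∣_∣)
open import Data.Fin.Subset.Properties using (_∈?_)
open import Data.Vec using (Vec; lookup)
open import Data.List using (List; []; _∷_; length)
open import Data.List.Relation.Unary.Unique.Propositional using (Unique)
open import Data.Product using (_×_; _,_; proj₁; proj₂)
open import Relation.Nullary using (Dec; yes; no)
open import Relation.Binary.PropositionalEquality using (_≡_)
open import Data.Sum using (_⊎_)

-- A literal over x_1..x_n: a coordinate together with a polarity
-- (true = x_i, false = negated x_i).
Literal : ℕ → Set
Literal n = Fin n × Bool

-- A term (conjunction of literals), identified with its set of literals,
-- represented as (set of positive indices, set of negated indices).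
-- Both x_i and ¬x_i may occur (arbitrary sets of literals).
Term : ℕ → Set
Term n = Subset n × Subset n

pos neg : ∀ {n} → Term n → Subset n
pos = proj₁
neg = proj₂

_∈ₜ_ : ∀ {n} → Literal n → Term n → Set
(i , true)  ∈ₜ T = i ∈ pos T
(i , false) ∈ₜ T = i ∈ neg T

_∈ₜ?_ : ∀ {n} (l : Literal n) (T : Term n) → Dec (l ∈ₜ T)
(i , true)  ∈ₜ? T = i ∈? pos T
(i , false) ∈ₜ? T = i ∈? neg T

size : ∀ {n} → Term n → ℕ
size T = ∣ pos T ∣ + ∣ neg T ∣

_∖ₜ_ : ∀ {n} → Term n → Term n → Term n
T ∖ₜ U = (pos T ─ pos U , neg T ─ neg U)

litOf : ∀ {n} → Vec Bool n → Fin n → Literal n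
litOf y i = (i , lookup y i)

Satisfies : ∀ {n} → Vec Bool n → Term n → Set
Satisfies {n} y T = ∀ (i : Fin n) (b : Bool) → (i , b) ∈ₜ T → lookup y i ≡ b

IndexIn : ∀ {n} → Fin n → Term n → Set
IndexIn i T = (i , true) ∈ₜ T ⊎ (i , false) ∈ₜ T

countContaining : ∀ {n} → Literal n → List (Term n) → ℕ
countContaining l [] = 0
countContaining l (T ∷ L) with l ∈ₜ? T
... | yes _ = suc (countContaining l L)
... | no  _ = countContaining l L

-- i is (z,L)-super popular: the literal of z_i appears in ≥ 0.01|L| terms,
-- i.e. 100 * count ≥ |L|.
SuperPopular : ∀ {n} → Vec Bool n → List (Term n) → Fin n → Set
SuperPopular z L i = length L ≤ 100 * countContaining (litOf z i) L

{-# OPTIONS --safe #-}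
-- Each T ∈ L shares at least 0.49a literals with T⋆: |T| ≥ 0.99a, and as ns ≥ 16 the bound
-- (ns)^|T ∖ T⋆| ≤ 4^a forces |T ∖ T⋆| ≤ a/2.  Double counting the pairs (T, ℓ) with
-- ℓ ∈ T ∩ T⋆, the literals of T⋆ occur at least 0.49a|L| times in L.  A literal occurs at most
-- |L| times, and the ≤ a literals occurring in fewer than 1% of the terms occur fewer than
-- a|L|/100 times together, so at least 0.48a literals of T⋆ occur in 1% of the terms.  As z
-- satisfies T⋆, each of them is the literal of z at its index, which is thus super popular.
module Submission where

open import Defs
open import Data.Nat using (ℕ; _+_; _*_; _^_; _≤_)
open import Data.Bool using (Bool)
open import Data.Vec using (Vec)
open import Data.List using (List)
open import Data.List.Relation.Unary.Unique.Propositional using (Unique)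
open import Data.List.Membership.Propositional using (_∈_)
open import Data.Fin using (Fin)
open import Data.Fin.Subset using (Subset; ∣_∣)
open import Data.Product using (Σ; ∃; _×_)
open import Relation.Binary.PropositionalEquality using (_≡_)
open import Data.Fin.Subset as S using ()

open import Data.Bool using (true; false)
open import Data.Fin using (zero; suc)
open import Data.Fin.Subset using (_⊆_; _∩_; _∪_; _─_)
open import Data.Fin.Subset.Properties
  using (_∈?_; x∈p∩q⁺; x∈p∩q⁻; x∈p∪q⁻; ∣p∣≤∣p∪q∣; ∣q∣≤∣p∪q∣; p⊆q⇒∣p∣≤∣q∣)
open import Data.List using ([]; _∷_; length)
import Data.List as List
open import Data.List.Membership.Propositional.Properties using (∈-lookup)
open import Data.Nat using (zero; suc; z≤n; s≤s; _<_; _≤ᵇ_)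
open import Data.Nat.Properties
open import Data.Nat.Tactic.RingSolver using (solve-∀)
open import Data.Product using (_,_; proj₁; proj₂)
open import Data.Sum using (inj₁; inj₂; [_,_]′)
open import Data.Vec using ([]; _∷_; lookup; tabulate)
open import Data.Vec.Properties using (lookup∘tabulate; []=⇒lookup; lookup⇒[]=)
open import Function using (_∘_)
open import Relation.Nullary using (does; yes; no; ofʸ; ofⁿ)
open import Relation.Binary.PropositionalEquality using (refl; sym; trans; cong; cong₂; subst)
open import Algebra.Properties.CommutativeSemigroup +-commutativeSemigroup using (interchange)
open import Algebra.Properties.Semiring.Sum +-*-semiring
  using (sum-syntax; sum-cong-≗; ∑-comm; ∑-distrib-+; *-distribˡ-sum; *-distribʳ-sum)
open ≤-Reasoning

𝟙 : Bool → ℕ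
𝟙 true  = 1
𝟙 false = 0

∑-mono-≤ : ∀ {n} {f g : Fin n → ℕ} → (∀ i → f i ≤ g i) → ∑[ i < n ] f i ≤ ∑[ i < n ] g i
∑-mono-≤ {zero}  f≤g = z≤n
∑-mono-≤ {suc n} f≤g = +-mono-≤ (f≤g zero) (∑-mono-≤ (f≤g ∘ suc))

∑-const : ∀ n c → ∑[ i < n ] c ≡ n * c
∑-const zero    c = refl
∑-const (suc n) c = cong (c +_) (∑-const n c)

∣p∣≡∑𝟙 : ∀ {n} (p : Subset n) → ∣ p ∣ ≡ ∑[ i < n ] 𝟙 (lookup p i)
∣p∣≡∑𝟙 []          = refl
∣p∣≡∑𝟙 (true  ∷ p) = cong suc (∣p∣≡∑𝟙 p)
∣p∣≡∑𝟙 (false ∷ p) = ∣p∣≡∑𝟙 p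

∣p∩q∣≡∑𝟙*𝟙 : ∀ {n} (p q : Subset n) →
  ∣ p ∩ q ∣ ≡ ∑[ i < n ] (𝟙 (lookup p i) * 𝟙 (lookup q i))
∣p∩q∣≡∑𝟙*𝟙 []          []          = refl
∣p∩q∣≡∑𝟙*𝟙 (true  ∷ p) (true  ∷ q) = cong suc (∣p∩q∣≡∑𝟙*𝟙 p q)
∣p∩q∣≡∑𝟙*𝟙 (true  ∷ p) (false ∷ q) = ∣p∩q∣≡∑𝟙*𝟙 p q
∣p∩q∣≡∑𝟙*𝟙 (false ∷ p) (_     ∷ q) = ∣p∩q∣≡∑𝟙*𝟙 p q

∣p∣≡∣p∩q∣+∣p─q∣ : ∀ {n} (p q : Subset n) → ∣ p ∣ ≡ ∣ p ∩ q ∣ + ∣ p ─ q ∣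
∣p∣≡∣p∩q∣+∣p─q∣ []          []          = refl
∣p∣≡∣p∩q∣+∣p─q∣ (true  ∷ p) (true  ∷ q) = cong suc (∣p∣≡∣p∩q∣+∣p─q∣ p q)
∣p∣≡∣p∩q∣+∣p─q∣ (true  ∷ p) (false ∷ q) =
  trans (cong suc (∣p∣≡∣p∩q∣+∣p─q∣ p q)) (sym (+-suc (∣ p ∩ q ∣) (∣ p ─ q ∣)))
∣p∣≡∣p∩q∣+∣p─q∣ (false ∷ p) (true  ∷ q) = ∣p∣≡∣p∩q∣+∣p─q∣ p q
∣p∣≡∣p∩q∣+∣p─q∣ (false ∷ p) (false ∷ q) = ∣p∣≡∣p∩q∣+∣p─q∣ p q

does-∈?≡lookup : ∀ {n} (i : Fin n) (p : Subset n) → does (i ∈? p) ≡ lookup p i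
does-∈?≡lookup zero    (true  ∷ p) = refl
does-∈?≡lookup zero    (false ∷ p) = refl
does-∈?≡lookup (suc i) (_     ∷ p) = does-∈?≡lookup i p

double-counting : ∀ {m n} (P : Fin m → Subset n) (q : Subset n) →
  ∑[ k < m ] ∣ P k ∩ q ∣ ≡ ∑[ i < n ] ((∑[ k < m ] 𝟙 (lookup (P k) i)) * 𝟙 (lookup q i))
double-counting {m} {n} P q = begin-equality
  ∑[ k < m ] ∣ P k ∩ q ∣
    ≡⟨ sum-cong-≗ (λ k → ∣p∩q∣≡∑𝟙*𝟙 (P k) q) ⟩
  ∑[ k < m ] ∑[ i < n ] (𝟙 (lookup (P k) i) * 𝟙 (lookup q i))
    ≡⟨ ∑-comm (λ k i → 𝟙 (lookup (P k) i) * 𝟙 (lookup q i)) ⟩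
  ∑[ i < n ] ∑[ k < m ] (𝟙 (lookup (P k) i) * 𝟙 (lookup q i))
    ≡⟨ sum-cong-≗ (λ i → sym (*-distribʳ-sum (𝟙 (lookup q i)) (λ k → 𝟙 (lookup (P k) i)))) ⟩
  ∑[ i < n ] ((∑[ k < m ] 𝟙 (lookup (P k) i)) * 𝟙 (lookup q i)) ∎

heavy : ∀ {n} → ℕ → ℕ → (Fin n → ℕ) → Subset n
heavy k m c = tabulate (λ i → m ≤ᵇ k * c i)

lookup-heavy : ∀ {n} k m (c : Fin n → ℕ) i → lookup (heavy k m c) i ≡ (m ≤ᵇ k * c i)
lookup-heavy k m c = lookup∘tabulate (λ i → m ≤ᵇ k * c i)

∈-heavy⁻ : ∀ {n k m} {c : Fin n → ℕ} {i} → i S.∈ heavy k m c → m ≤ k * c i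
∈-heavy⁻ {k = k} {m} {c} {i} i∈H
  with m ≤ᵇ k * c i | ≤ᵇ-reflects-≤ m (k * c i)
     | trans (sym (lookup-heavy k m c i)) ([]=⇒lookup i∈H)
... | true | ofʸ m≤kc | _ = m≤kc

∈-heavy-0 : ∀ {n} k (c : Fin n → ℕ) i → i S.∈ heavy k 0 c
∈-heavy-0 k c i = lookup⇒[]= i _ (lookup-heavy k 0 c i)

heavy-pointwise : ∀ {k m c} → c ≤ m → ∀ x →
  k * (c * 𝟙 x) ≤ m * (k * (𝟙 x * 𝟙 (m ≤ᵇ k * c)) + 𝟙 x)
heavy-pointwise {k} {m} {c} c≤m false rewrite *-zeroʳ c | *-zeroʳ k = z≤n
heavy-pointwise {k} {m} {c} c≤m true with m ≤ᵇ k * c | ≤ᵇ-reflects-≤ m (k * c)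
... | true | ofʸ _ rewrite *-identityʳ c | *-identityʳ k = begin
  k * c       ≤⟨ *-monoʳ-≤ k c≤m ⟩
  k * m       ≡⟨ *-comm k m ⟩
  m * k       ≤⟨ *-monoʳ-≤ m (m≤m+n k 1) ⟩
  m * (k + 1) ∎
... | false | ofⁿ m≰kc rewrite *-identityʳ c | *-zeroʳ k | *-identityʳ m = <⇒≤ (≰⇒> m≰kc)

-- Markov: a heavy coordinate of q contributes k * c i ≤ k * m, a light one k * c i < m.
heavy-bound : ∀ {n} k m (c : Fin n → ℕ) (q : Subset n) → (∀ i → c i ≤ m) →
  k * ∑[ i < n ] (c i * 𝟙 (lookup q i)) ≤ m * (k * ∣ q ∩ heavy k m c ∣ + ∣ q ∣)
heavy-bound {n} k m c q c≤m = begin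
  k * ∑[ i < n ] (c i * qᵢ i)
    ≡⟨ *-distribˡ-sum k (λ i → c i * qᵢ i) ⟩
  ∑[ i < n ] (k * (c i * qᵢ i))
    ≤⟨ ∑-mono-≤ (λ i → heavy-pointwise {k} (c≤m i) (lookup q i)) ⟩
  ∑[ i < n ] (m * (k * (qᵢ i * hᵢ i) + qᵢ i))
    ≡⟨ *-distribˡ-sum m (λ i → k * (qᵢ i * hᵢ i) + qᵢ i) ⟨
  m * ∑[ i < n ] (k * (qᵢ i * hᵢ i) + qᵢ i)
    ≡⟨ cong (m *_) (∑-distrib-+ (λ i → k * (qᵢ i * hᵢ i)) qᵢ) ⟩
  m * (∑[ i < n ] (k * (qᵢ i * hᵢ i)) + ∑[ i < n ] qᵢ i)
    ≡⟨ cong (m *_) (cong₂ _+_ (*-distribˡ-sum k (λ i → qᵢ i * hᵢ i)) (∣p∣≡∑𝟙 q)) ⟨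
  m * (k * ∑[ i < n ] (qᵢ i * hᵢ i) + ∣ q ∣)
    ≡⟨ cong (λ x → m * (k * x + ∣ q ∣)) (sum-cong-≗ (cong (λ b → qᵢ _ * 𝟙 b) ∘ lookup-heavy k m c)) ⟨
  m * (k * ∑[ i < n ] (qᵢ i * 𝟙 (lookup (heavy k m c) i)) + ∣ q ∣)
    ≡⟨ cong (λ x → m * (k * x + ∣ q ∣)) (∣p∩q∣≡∑𝟙*𝟙 q (heavy k m c)) ⟨
  m * (k * ∣ q ∩ heavy k m c ∣ + ∣ q ∣) ∎
  where
  qᵢ hᵢ : Fin n → ℕ
  qᵢ i = 𝟙 (lookup q i)
  hᵢ i = 𝟙 (m ≤ᵇ k * c i)

_∩ₜ_ : ∀ {n} → Term n → Term n → Term n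
T ∩ₜ U = (pos T ∩ pos U , neg T ∩ neg U)

size≡size∩ₜ+size∖ₜ : ∀ {n} (T U : Term n) → size T ≡ size (T ∩ₜ U) + size (T ∖ₜ U)
size≡size∩ₜ+size∖ₜ T U =
  trans (cong₂ _+_ (∣p∣≡∣p∩q∣+∣p─q∣ (pos T) (pos U)) (∣p∣≡∣p∩q∣+∣p─q∣ (neg T) (neg U)))
        (interchange (∣ pos T ∩ pos U ∣) (∣ pos T ─ pos U ∣) (∣ neg T ∩ neg U ∣) (∣ neg T ─ neg U ∣))

^-cancelˡ-≤ : ∀ b {m n} → 1 < b → b ^ m ≤ b ^ n → m ≤ n
^-cancelˡ-≤ b 1<b bᵐ≤bⁿ = ≮⇒≥ (λ n<m → <⇒≱ (^-monoʳ-< b 1<b n<m) bᵐ≤bⁿ)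

exponent-bound : ∀ {b} k d e → 2 ^ k ≤ b → b ^ d ≤ 2 ^ e → k * d ≤ e
exponent-bound {b} k d e 2ᵏ≤b bᵈ≤2ᵉ = ^-cancelˡ-≤ 2 ≤-refl (begin
  2 ^ (k * d)  ≡⟨ ^-*-assoc 2 k d ⟨
  (2 ^ k) ^ d  ≤⟨ ^-monoˡ-≤ d 2ᵏ≤b ⟩
  b ^ d        ≤⟨ bᵈ≤2ᵉ ⟩
  2 ^ e        ∎)

overlap-large : ∀ {n} a (T S : Term n) →
  99 * a ≤ 100 * size T → 4 * size (T ∖ₜ S) ≤ 2 * a → 49 * a ≤ 100 * size (T ∩ₜ S)
overlap-large a T S large close = +-cancelʳ-≤ (50 * a) (49 * a) (100 * x) (begin
  49 * a + 50 * a          ≡⟨ *-distribʳ-+ a 49 50 ⟨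
  99 * a                   ≤⟨ large ⟩
  100 * size T             ≡⟨ cong (100 *_) (size≡size∩ₜ+size∖ₜ T S) ⟩
  100 * (x + d)            ≡⟨ *-distribˡ-+ 100 x d ⟩
  100 * x + 100 * d        ≡⟨ cong (100 * x +_) (*-assoc 25 4 d) ⟩
  100 * x + 25 * (4 * d)   ≤⟨ +-monoʳ-≤ (100 * x) (*-monoʳ-≤ 25 close) ⟩
  100 * x + 25 * (2 * a)   ≡⟨ cong (100 * x +_) (*-assoc 25 2 a) ⟨
  100 * x + 50 * a         ∎)
  where
  x = size (T ∩ₜ S)
  d = size (T ∖ₜ S)

lits : ∀ {n} → Bool → Term n → Subset n
lits true  = pos
lits false = neg

∈lits⇒∈ₜ : ∀ {n} b {i : Fin n} {T} → i S.∈ lits b T → (i , b) ∈ₜ T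
∈lits⇒∈ₜ true  i∈T = i∈T
∈lits⇒∈ₜ false i∈T = i∈T

∈lits⇒IndexIn : ∀ {n} b {i : Fin n} {T} → i S.∈ lits b T → IndexIn i T
∈lits⇒IndexIn true  = inj₁
∈lits⇒IndexIn false = inj₂

does-∈ₜ?≡lookup-lits : ∀ {n} (i : Fin n) b T → does ((i , b) ∈ₜ? T) ≡ lookup (lits b T) i
does-∈ₜ?≡lookup-lits i true  T = does-∈?≡lookup i (pos T)
does-∈ₜ?≡lookup-lits i false T = does-∈?≡lookup i (neg T)

countContaining≡∑ : ∀ {n} (l : Literal n) L →
  countContaining l L ≡ ∑[ k < length L ] 𝟙 (does (l ∈ₜ? List.lookup L k))
countContaining≡∑ l []      = refl
countContaining≡∑ l (T ∷ L) with l ∈ₜ? T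
... | yes _ = cong suc (countContaining≡∑ l L)
... | no  _ = countContaining≡∑ l L

countContaining≤length : ∀ {n} (l : Literal n) L → countContaining l L ≤ length L
countContaining≤length l []      = z≤n
countContaining≤length l (T ∷ L) with l ∈ₜ? T
... | yes _ = s≤s (countContaining≤length l L)
... | no  _ = m≤n⇒m≤1+n (countContaining≤length l L)

module _ {n} (L : List (Term n)) where

  popular : Bool → Term n → Subset n
  popular b S = lits b S ∩ heavy 100 (length L) (λ i → countContaining (i , b) L)

  superPopularIndices : Term n → Subset n
  superPopularIndices S = popular true S ∪ popular false S

  popular-sound : ∀ {z S} b {i} → Satisfies z S → i S.∈ popular b S →
    SuperPopular z L i × IndexIn i S
  popular-sound {z} {S} b {i} sat i∈P =
    subst (λ x → length L ≤ 100 * countContaining (i , x) L) (sym zᵢ≡b) popular-lit ,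
    ∈lits⇒IndexIn b i∈S
    where
    i∈S = proj₁ (x∈p∩q⁻ (lits b S) _ i∈P)
    i∈H = proj₂ (x∈p∩q⁻ (lits b S) _ i∈P)
    zᵢ≡b : lookup z i ≡ b
    zᵢ≡b = sat i b (∈lits⇒∈ₜ b i∈S)
    popular-lit : length L ≤ 100 * countContaining (i , b) L
    popular-lit = ∈-heavy⁻ {k = 100} {length L} {λ j → countContaining (j , b) L} i∈H

  superPopularIndices-sound : ∀ {z S i} → Satisfies z S → i S.∈ superPopularIndices S →
    SuperPopular z L i × IndexIn i S
  superPopularIndices-sound {z} sat i∈C =
    [ popular-sound {z} true sat , popular-sound {z} false sat ]′ (x∈p∪q⁻ _ _ i∈C)

  ∣popular∣+∣popular∣≤ : ∀ S →
    ∣ popular true S ∣ + ∣ popular false S ∣ ≤ ∣ superPopularIndices S ∣ + ∣ superPopularIndices S ∣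
  ∣popular∣+∣popular∣≤ S =
    +-mono-≤ (∣p∣≤∣p∪q∣ (popular true S) (popular false S))
             (∣q∣≤∣p∪q∣ (popular true S) (popular false S))

  overlap-lits-bound : ∀ b S →
    100 * ∑[ k < length L ] ∣ lits b (List.lookup L k) ∩ lits b S ∣
      ≤ length L * (100 * ∣ popular b S ∣ + ∣ lits b S ∣)
  overlap-lits-bound b S = begin
    100 * ∑[ k < m ] ∣ lits b (Lₖ k) ∩ lits b S ∣
      ≡⟨ cong (100 *_) (double-counting (λ k → lits b (Lₖ k)) (lits b S)) ⟩
    100 * ∑[ i < n ] ((∑[ k < m ] 𝟙 (lookup (lits b (Lₖ k)) i)) * 𝟙 (lookup (lits b S) i))
      ≡⟨ cong (100 *_) (sum-cong-≗ (λ i → cong (_* 𝟙 (lookup (lits b S) i)) (count≡∑ i))) ⟨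
    100 * ∑[ i < n ] (countContaining (i , b) L * 𝟙 (lookup (lits b S) i))
      ≤⟨ heavy-bound 100 m (λ i → countContaining (i , b) L) (lits b S)
                     (λ i → countContaining≤length (i , b) L) ⟩
    m * (100 * ∣ popular b S ∣ + ∣ lits b S ∣) ∎
    where
    m = length L
    Lₖ = List.lookup L
    count≡∑ : ∀ i → countContaining (i , b) L ≡ ∑[ k < m ] 𝟙 (lookup (lits b (Lₖ k)) i)
    count≡∑ i = trans (countContaining≡∑ (i , b) L)
                      (sum-cong-≗ (λ k → cong 𝟙 (does-∈ₜ?≡lookup-lits i b (Lₖ k))))

  overlap-bound : ∀ S →
    100 * ∑[ k < length L ] size (List.lookup L k ∩ₜ S)
      ≤ length L * (100 * (∣ popular true S ∣ + ∣ popular false S ∣) + size S)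
  overlap-bound S = begin
    100 * ∑[ k < m ] size (Lₖ k ∩ₜ S)
      ≡⟨ cong (100 *_) (∑-distrib-+ (λ k → ∣ pos (Lₖ k) ∩ pos S ∣) (λ k → ∣ neg (Lₖ k) ∩ neg S ∣)) ⟩
    100 * (X true + X false)
      ≡⟨ *-distribˡ-+ 100 (X true) (X false) ⟩
    100 * X true + 100 * X false
      ≤⟨ +-mono-≤ (overlap-lits-bound true S) (overlap-lits-bound false S) ⟩
    m * (100 * ∣ popular true S ∣ + ∣ pos S ∣) + m * (100 * ∣ popular false S ∣ + ∣ neg S ∣)
      ≡⟨ regroup m (∣ popular true S ∣) (∣ popular false S ∣) (∣ pos S ∣) (∣ neg S ∣) ⟩
    m * (100 * (∣ popular true S ∣ + ∣ popular false S ∣) + size S) ∎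
    where
    m = length L
    Lₖ = List.lookup L
    X : Bool → ℕ
    X b = ∑[ k < m ] ∣ lits b (Lₖ k) ∩ lits b S ∣
    regroup : ∀ m x y p q →
      m * (100 * x + p) + m * (100 * y + q) ≡ m * (100 * (x + y) + (p + q))
    regroup = solve-∀

size≤∣popular[]∣+∣popular[]∣ : ∀ {n} (S : Term n) →
  size S ≤ ∣ popular [] true S ∣ + ∣ popular [] false S ∣
size≤∣popular[]∣+∣popular[]∣ S =
  +-mono-≤ (p⊆q⇒∣p∣≤∣q∣ (lits⊆popular[] true)) (p⊆q⇒∣p∣≤∣q∣ (lits⊆popular[] false))
  where
  lits⊆popular[] : ∀ b → lits b S ⊆ popular [] b S
  lits⊆popular[] b {i} i∈S = x∈p∩q⁺ (i∈S , ∈-heavy-0 100 (λ j → countContaining (j , b) []) i)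

c+c≤100*c : ∀ c → c + c ≤ 100 * c
c+c≤100*c c = +-monoʳ-≤ c (m≤n*m c 99)

a≤100*c : ∀ a c → 49 * a ≤ 100 * (c + c) + a → a ≤ 100 * c
a≤100*c a c 49a≤ = *-cancelˡ-≤ 2 (begin
  2 * a         ≤⟨ *-monoˡ-≤ a {2} {48} (s≤s (s≤s z≤n)) ⟩
  48 * a        ≤⟨ +-cancelʳ-≤ a (48 * a) (100 * (c + c)) 48a+a≤ ⟩
  100 * (c + c) ≡⟨ double c ⟩
  2 * (100 * c) ∎)
  where
  48a+a≤ : 48 * a + a ≤ 100 * (c + c) + a
  48a+a≤ = ≤-trans (≤-reflexive (+-comm (48 * a) a)) 49a≤
  double : ∀ c → 100 * (c + c) ≡ 2 * (100 * c)
  double = solve-∀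

size≤100*∣superPopularIndices∣ : ∀ {n} (L : List (Term n)) S →
  (∀ T → T ∈ L → 49 * size S ≤ 100 * size (T ∩ₜ S)) → size S ≤ 100 * ∣ superPopularIndices L S ∣
size≤100*∣superPopularIndices∣ [] S _ =
  ≤-trans (≤-trans (size≤∣popular[]∣+∣popular[]∣ S) (∣popular∣+∣popular∣≤ [] S))
          (c+c≤100*c ∣ superPopularIndices [] S ∣)
size≤100*∣superPopularIndices∣ L@(_ ∷ _) S overlaps = a≤100*c (size S) ∣ C ∣ (*-cancelˡ-≤ m (begin
  m * (49 * size S)                       ≡⟨ ∑-const m (49 * size S) ⟨
  ∑[ k < m ] (49 * size S)                ≤⟨ ∑-mono-≤ (λ k → overlaps (Lₖ k) (∈-lookup k)) ⟩
  ∑[ k < m ] (100 * size (Lₖ k ∩ₜ S))     ≡⟨ *-distribˡ-sum 100 (λ k → size (Lₖ k ∩ₜ S)) ⟨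
  100 * ∑[ k < m ] size (Lₖ k ∩ₜ S)       ≤⟨ overlap-bound L S ⟩
  m * (100 * (∣ P₊ ∣ + ∣ P₋ ∣) + size S)  ≤⟨ *-monoʳ-≤ m (+-monoˡ-≤ (size S) (*-monoʳ-≤ 100 P₊+P₋≤2C)) ⟩
  m * (100 * (∣ C ∣ + ∣ C ∣) + size S)    ∎))
  where
  m = length L
  Lₖ = List.lookup L
  P₊ = popular L true S
  P₋ = popular L false S
  C = superPopularIndices L S
  P₊+P₋≤2C : ∣ P₊ ∣ + ∣ P₋ ∣ ≤ ∣ C ∣ + ∣ C ∣
  P₊+P₋≤2C = ∣popular∣+∣popular∣≤ L S

lemma9p14 : Σ ℕ λ N₀ → ∀ (n s : ℕ) → N₀ ≤ n → N₀ ≤ s →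
    ∀ (z : Vec Bool n) (Tstar : Term n) (a : ℕ) → Satisfies z Tstar → size Tstar ≡ a →
    ∀ (L : List (Term n)) → Unique L →
    (∀ T → T ∈ L → 99 * a ≤ 100 * size T) →
    (∀ T → T ∈ L → (n * s) ^ size (T ∖ₜ Tstar) ≤ 2 ^ (2 * a)) →
    ∃ λ (C : Subset n) → (∀ i → i S.∈ C → SuperPopular z L i × IndexIn i Tstar) × a ≤ 100 * ∣ C ∣
lemma9p14 = 4 , λ { n s 4≤n 4≤s z T⋆ .(size T⋆) sat refl L _ large close →
  superPopularIndices L T⋆ ,
  (λ i → superPopularIndices-sound L {z} sat) ,
  size≤100*∣superPopularIndices∣ L T⋆ (λ T T∈L →
    overlap-large (size T⋆) T T⋆ (large T T∈L)
      (exponent-bound 4 (size (T ∖ₜ T⋆)) (2 * size T⋆) (*-mono-≤ 4≤n 4≤s) (close T T∈L))) }
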